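{- Let $n \geq 2$ and let $v_1, \dots, v_{2^{n-1}} \in \mathbb{F}_2^n$ be nonzero vectors such that $v_{2i-1} = v_{2i}$ for all $1 \leq i \leq 2^{n-2}$, and such that there are at most $l < n$ distinct vectors among the $v_i$. Then there exist vectors $p_1, q_1, \dots, p_{2^{n-1}}, q_{2^{n-1}}$ forming exactly the $2^n$ elements of $\mathbb{F}_2^n$ (each once) with $p_i + q_i = v_i$ for all $1 \leq i \leq 2^{n-1}$. -}

module Defs where

open import Data.Bool using (Bool; _xor_)
open import Data.Nat using (ℕ)
open import Data.Vec using (Vec; zipWith; replicate)

F₂^ : ℕ → Set
F₂^ n = Vec Bool n

_⊕_ : ∀ {n} → F₂^ n → F₂^ n → F₂^ n
_⊕_ = zipWith _xor_

𝟎 : ∀ {n} → F₂^ n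
𝟎 = replicate _ Bool.false
  where open import Data.Bool

module Submission where

-- Lemma 6.  Write n = m + 2 and N = 2ᵐ⁺¹.  Since v₂ₖ = v₂ₖ₊₁, the list
-- (v₀, …, v_{N−1}) is a rearrangement of ws ++ ws for a list ws of 2ᵐ
-- nonzero vectors taking at most l ≤ m + 1 values.  A *pairing* for a list ds
-- of vectors of F₂ⁿ is a partition of F₂ⁿ into ordered pairs (pᵢ, qᵢ) with
-- pᵢ + qᵢ = dᵢ; pairings can be reordered along with ds and transported by
-- linear automorphisms.  By induction on k, ws ++ ws has a pairing whenever
-- ws consists of 2ᵏ nonzero vectors of F₂ᵏ⁺² taking at most k + 1 values:
--   * at most k + 1 vectors of F₂ᵏ⁺² lie in a hyperplane, so after an
--     automorphism (Gaussian elimination) every wᵢ is (0, tᵢ) with tᵢ ≠ 0;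
--   * pairings of two lists of tails in F₂ᵏ⁺¹, prefixed by 0 and by 1, form a
--     pairing of the (0, t)-vectors.  For k = 0 the tail is (1), paired as
--     ((0), (1)); for k = j + 1 the tails split into two halves of 2ʲ entries
--     with at most j + 1 values each (of three values, two occur at most 2ʲ
--     times: put one first, the other last, and cut in the middle), and the
--     induction hypothesis pairs each doubled half.

open import Defs
open import Data.Nat using (ℕ; suc; _*_; _^_; _<_)
open import Data.Fin using (Fin; toℕ)
open import Data.List using (List; length)
open import Data.List.Membership.Propositional using (_∈_)
open import Data.Sum using (_⊎_; [_,_])
open import Data.Product using (Σ-syntax; _×_)
open import Function.Definitions using (Bijective)
open import Relation.Binary.PropositionalEquality using (_≡_; _≢_)

open import Data.Bool using (true; false; _xor_)
import Data.Bool.Properties as Bool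
open import Data.Nat using (zero; _+_; _∸_; _⊓_; _≤_; z≤n; s≤s; _≤?_)
open import Data.Nat.Properties
  using (≤-pred; ≤-reflexive; ≤-trans; *-suc; +-identityʳ; +-monoʳ-≤; +-mono-<; +-mono-<-≤;
         m≤m+n; m≤n+m; m≤n⇒m⊓n≡m; m+n∸m≡n; ≰⇒>; ≮⇒≥; <⇒≱; module ≤-Reasoning)
import Data.Fin as Fin
open import Data.Vec using ([]; _∷_; head; tail)
import Data.Vec.Properties as Vec
open import Data.List using (map; []; _∷_; _++_; take; drop; filter; deduplicate; tabulate)
open import Data.List.Properties
  using (∷-injectiveˡ; ∷-injectiveʳ; length-map; length-++; length-take; length-drop; length-deduplicate;
         take++drop≡id; filter-notAll; map-tabulate; map-∘; map-cong; map-cong-local; map-id; map-++; ++-assoc)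
open import Data.List.Membership.Propositional.Properties
  using (∈-map⁺; ∈-map⁻; ∈-++⁺ˡ; ∈-++⁺ʳ; ∈-++⁻; ∈-filter⁺; ∈-deduplicate⁺; ∈-tabulate⁺; ∈-tabulate⁻)
open import Data.List.Relation.Unary.All as All using (All; []; _∷_)
import Data.List.Relation.Unary.All.Properties as All
open import Data.List.Relation.Unary.Any as Any using (here; there)
open import Data.List.Relation.Unary.AllPairs using ([]; _∷_)
open import Data.List.Relation.Unary.Unique.Propositional using (Unique)
import Data.List.Relation.Unary.Unique.Propositional.Properties as Unique
open import Data.List.Relation.Unary.Unique.DecPropositional.Properties using (deduplicate-!)
open import Data.List.Relation.Binary.Disjoint.Propositional using (Disjoint)
open import Data.List.Relation.Binary.Permutation.Propositional
  using (_↭_; ↭-refl; ↭-reflexive; ↭-sym; ↭-trans; ↭-prep; ↭-swap; ↭⇒↭ₛ; module PermutationReasoning)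
open import Data.List.Relation.Binary.Permutation.Propositional.Properties
  using (All-resp-↭; ∈-resp-↭; ↭-length; shift; shifts; ++⁺; ++⁺ˡ; map⁺; ↭-map-inv)
import Data.List.Relation.Binary.Permutation.Setoid.Properties as ↭ₛ
open import Data.Sum using (inj₁; inj₂)
open import Data.Product using (_,_; proj₁; proj₂; uncurry)
open import Data.Empty using (⊥-elim)
open import Function using (_∘_)
open import Relation.Nullary using (yes; no; ¬?; _×-dec_)
open import Relation.Unary using (Decidable)
open import Relation.Binary using (DecidableEquality)
open import Relation.Binary.PropositionalEquality
  using (refl; sym; trans; cong; cong₂; subst; setoid; module ≡-Reasoning)

⊕-assoc : ∀ {n} (x y z : F₂^ n) → (x ⊕ y) ⊕ z ≡ x ⊕ (y ⊕ z)
⊕-assoc = Vec.zipWith-assoc Bool.xor-assoc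

⊕-comm : ∀ {n} (x y : F₂^ n) → x ⊕ y ≡ y ⊕ x
⊕-comm = Vec.zipWith-comm Bool.xor-comm

⊕-identityʳ : ∀ {n} (x : F₂^ n) → x ⊕ 𝟎 ≡ x
⊕-identityʳ = Vec.zipWith-identityʳ Bool.xor-identityʳ

⊕-self : ∀ {n} (x : F₂^ n) → x ⊕ x ≡ 𝟎
⊕-self []      = refl
⊕-self (b ∷ x) = cong₂ _∷_ (Bool.xor-same b) (⊕-self x)

⊕-cancelʳ : ∀ {n} (x w : F₂^ n) → (x ⊕ w) ⊕ w ≡ x
⊕-cancelʳ x w = begin
  (x ⊕ w) ⊕ w  ≡⟨ ⊕-assoc x w w ⟩
  x ⊕ (w ⊕ w)  ≡⟨ cong (x ⊕_) (⊕-self w) ⟩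
  x ⊕ 𝟎        ≡⟨ ⊕-identityʳ x ⟩
  x            ∎
  where open ≡-Reasoning

⊕-interchange : ∀ {n} (x y z u : F₂^ n) → (x ⊕ y) ⊕ (z ⊕ u) ≡ (x ⊕ z) ⊕ (y ⊕ u)
⊕-interchange x y z u = begin
  (x ⊕ y) ⊕ (z ⊕ u)  ≡⟨ ⊕-assoc x y (z ⊕ u) ⟩
  x ⊕ (y ⊕ (z ⊕ u))  ≡⟨ cong (x ⊕_) (sym (⊕-assoc y z u)) ⟩
  x ⊕ ((y ⊕ z) ⊕ u)  ≡⟨ cong (λ t → x ⊕ (t ⊕ u)) (⊕-comm y z) ⟩
  x ⊕ ((z ⊕ y) ⊕ u)  ≡⟨ cong (x ⊕_) (⊕-assoc z y u) ⟩
  x ⊕ (z ⊕ (y ⊕ u))  ≡⟨ sym (⊕-assoc x z (y ⊕ u)) ⟩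
  (x ⊕ z) ⊕ (y ⊕ u)  ∎
  where open ≡-Reasoning

record Automorphism (n : ℕ) : Set where
  field
    to from : F₂^ n → F₂^ n
    from-to : ∀ x → from (to x) ≡ x
    to-from : ∀ x → to (from x) ≡ x
    to-⊕    : ∀ x y → to (x ⊕ y) ≡ to x ⊕ to y

  to-𝟎 : to 𝟎 ≡ 𝟎
  to-𝟎 = begin
    to 𝟎            ≡⟨ cong to (sym (⊕-self 𝟎)) ⟩
    to (𝟎 ⊕ 𝟎)      ≡⟨ to-⊕ 𝟎 𝟎 ⟩
    to 𝟎 ⊕ to 𝟎     ≡⟨ ⊕-self (to 𝟎) ⟩
    𝟎               ∎
    where open ≡-Reasoning

  from-⊕ : ∀ x y → from (x ⊕ y) ≡ from x ⊕ from y
  from-⊕ x y = begin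
    from (x ⊕ y)                       ≡⟨ cong from (sym (cong₂ _⊕_ (to-from x) (to-from y))) ⟩
    from (to (from x) ⊕ to (from y))   ≡⟨ cong from (sym (to-⊕ (from x) (from y))) ⟩
    from (to (from x ⊕ from y))        ≡⟨ from-to (from x ⊕ from y) ⟩
    from x ⊕ from y                    ∎
    where open ≡-Reasoning

  to-injective : ∀ {x y} → to x ≡ to y → x ≡ y
  to-injective {x} {y} eq = trans (sym (from-to x)) (trans (cong from eq) (from-to y))

  from-injective : ∀ {x y} → from x ≡ from y → x ≡ y
  from-injective {x} {y} eq = trans (sym (to-from x)) (trans (cong to eq) (to-from y))

open Automorphism

involution : ∀ {n} (f : F₂^ n → F₂^ n) → (∀ x → f (f x) ≡ x) →
             (∀ x y → f (x ⊕ y) ≡ f x ⊕ f y) → Automorphism n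
involution f ff f-⊕ = record { to = f ; from = f ; from-to = ff ; to-from = ff ; to-⊕ = f-⊕ }

identity : ∀ {n} → Automorphism n
identity = involution (λ x → x) (λ _ → refl) (λ _ _ → refl)

_∘ᵃ_ : ∀ {n} → Automorphism n → Automorphism n → Automorphism n
φ ∘ᵃ ψ = record
  { to      = to φ ∘ to ψ
  ; from    = from ψ ∘ from φ
  ; from-to = λ x → trans (cong (from ψ) (from-to φ (to ψ x))) (from-to ψ x)
  ; to-from = λ x → trans (cong (to φ) (to-from ψ (from φ x))) (to-from φ x)
  ; to-⊕    = λ x y → trans (cong (to φ) (to-⊕ ψ x y)) (to-⊕ φ (to ψ x) (to ψ y))
  }

lift : ∀ {n} → Automorphism n → Automorphism (suc n)
lift ψ = record
  { to      = λ { (b ∷ x) → b ∷ to ψ x }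
  ; from    = λ { (b ∷ x) → b ∷ from ψ x }
  ; from-to = λ { (b ∷ x) → cong (b ∷_) (from-to ψ x) }
  ; to-from = λ { (b ∷ x) → cong (b ∷_) (to-from ψ x) }
  ; to-⊕    = λ { (b ∷ x) (c ∷ y) → cong ((b xor c) ∷_) (to-⊕ ψ x y) }
  }

swap : ∀ {n} → F₂^ (suc (suc n)) → F₂^ (suc (suc n))
swap (a ∷ b ∷ x) = b ∷ a ∷ x

swap-aut : ∀ {n} → Automorphism (suc (suc n))
swap-aut = involution swap (λ { (a ∷ b ∷ x) → refl }) (λ { (a ∷ b ∷ x) (c ∷ d ∷ y) → refl })

shear : ∀ {n} → F₂^ n → F₂^ (suc n) → F₂^ (suc n)
shear w (false ∷ x) = false ∷ x
shear w (true ∷ x)  = true ∷ (x ⊕ w)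

shear-involutive : ∀ {n} (w : F₂^ n) x → shear w (shear w x) ≡ x
shear-involutive w (false ∷ x) = refl
shear-involutive w (true ∷ x)  = cong (true ∷_) (⊕-cancelʳ x w)

shear-⊕ : ∀ {n} (w : F₂^ n) x y → shear w (x ⊕ y) ≡ shear w x ⊕ shear w y
shear-⊕ w (false ∷ x) (false ∷ y) = refl
shear-⊕ w (false ∷ x) (true ∷ y)  = cong (true ∷_) (⊕-assoc x y w)
shear-⊕ w (true ∷ x)  (false ∷ y) = cong (true ∷_) (begin
  (x ⊕ y) ⊕ w  ≡⟨ ⊕-assoc x y w ⟩
  x ⊕ (y ⊕ w)  ≡⟨ cong (x ⊕_) (⊕-comm y w) ⟩
  x ⊕ (w ⊕ y)  ≡⟨ sym (⊕-assoc x w y) ⟩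
  (x ⊕ w) ⊕ y  ∎)
  where open ≡-Reasoning
shear-⊕ w (true ∷ x)  (true ∷ y)  = cong (false ∷_) (begin
  x ⊕ y              ≡⟨ sym (⊕-identityʳ (x ⊕ y)) ⟩
  (x ⊕ y) ⊕ 𝟎        ≡⟨ cong ((x ⊕ y) ⊕_) (sym (⊕-self w)) ⟩
  (x ⊕ y) ⊕ (w ⊕ w)  ≡⟨ ⊕-interchange x y w w ⟩
  (x ⊕ w) ⊕ (y ⊕ w)  ∎)
  where open ≡-Reasoning

shear-aut : ∀ {n} → F₂^ n → Automorphism (suc n)
shear-aut w = involution (shear w) (shear-involutive w) (shear-⊕ w)

InHyperplane : ∀ {n} → F₂^ (suc n) → Set
InHyperplane x = head x ≡ false

find-pivot : ∀ {n} (S : List (F₂^ (suc n))) →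
             All InHyperplane S ⊎ Σ[ w ∈ F₂^ n ] Σ[ S₀ ∈ List (F₂^ (suc n)) ] (S ↭ (true ∷ w) ∷ S₀)
find-pivot []               = inj₁ []
find-pivot ((true ∷ w) ∷ S) = inj₂ (w , S , ↭-refl)
find-pivot ((false ∷ x) ∷ S) with find-pivot S
... | inj₁ in-S              = inj₁ (refl ∷ in-S)
... | inj₂ (w , S₀ , S↭)     = inj₂ (w , (false ∷ x) ∷ S₀ , ↭-trans (↭-prep _ S↭) (↭-swap _ _ ↭-refl))

-- Gaussian elimination: shear a pivot (1, w) to (1, 0), treat
-- the tails of the remaining vectors recursively, and swap the first two
-- coordinates.
hyperplane : ∀ n (S : List (F₂^ (suc n))) → length S ≤ n →
             Σ[ ψ ∈ Automorphism (suc n) ] All (InHyperplane ∘ to ψ) S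
hyperplane zero    []  _      = identity , []
hyperplane (suc n) S   |S|≤n  with find-pivot S
... | inj₁ in-S           = identity , in-S
... | inj₂ (w , S₀ , S↭)  = ψ , All-resp-↭ (↭-sym S↭) (pivot-in ∷ All.map (λ {x} → rest-in {x}) (All.map⁻ in-rest))
  where
    tails : List (F₂^ (suc n))
    tails = map (tail ∘ shear w) S₀

    |tails|≤n : length tails ≤ n
    |tails|≤n = ≤-pred (subst (_≤ suc n) (trans (↭-length S↭) (cong suc (sym (length-map _ S₀)))) |S|≤n)

    ψ′ : Automorphism (suc n)
    ψ′ = proj₁ (hyperplane n tails |tails|≤n)

    in-rest : All (InHyperplane ∘ to ψ′) tails
    in-rest = proj₂ (hyperplane n tails |tails|≤n)

    ψ : Automorphism (suc (suc n))
    ψ = swap-aut ∘ᵃ (lift ψ′ ∘ᵃ shear-aut w)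

    open ≡-Reasoning

    head-swap-lift : ∀ y → head (swap (to (lift ψ′) y)) ≡ head (to ψ′ (tail y))
    head-swap-lift (b ∷ t) with to ψ′ t
    ... | c ∷ _ = refl

    rest-in : ∀ {x} → InHyperplane (to ψ′ (tail (shear w x))) → InHyperplane (to ψ x)
    rest-in {x} = trans (head-swap-lift (shear w x))

    pivot-in : InHyperplane (to ψ (true ∷ w))
    pivot-in = rest-in {true ∷ w} (begin
      head (to ψ′ (w ⊕ w))  ≡⟨ cong (head ∘ to ψ′) (⊕-self w) ⟩
      head (to ψ′ 𝟎)        ≡⟨ cong head (to-𝟎 ψ′) ⟩
      false                 ∎)

AtMostValues : ∀ {A : Set} → ℕ → List A → Set
AtMostValues {A} b xs = Σ[ S ∈ List A ] (length S ≤ b × All (_∈ S) xs)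

hyperplane-form : ∀ {n} {x : F₂^ (suc n)} → InHyperplane x → x ≡ false ∷ tail x
hyperplane-form {x = false ∷ t} refl = refl

record Reduction {n} (ws : List (F₂^ (suc n))) : Set where
  field
    ψ            : Automorphism (suc n)
    tails        : List (F₂^ n)
    moved        : map (to ψ) ws ≡ map (false ∷_) tails
    length-tails : length tails ≡ length ws
    nonzero      : All (_≢ 𝟎) tails
    values       : AtMostValues n tails

reduce-dimension : ∀ {n} (ws : List (F₂^ (suc n))) → All (_≢ 𝟎) ws → AtMostValues n ws → Reduction ws
reduce-dimension {n} ws ws≢𝟎 (S , |S|≤n , ws⊆S) = record
  { ψ            = ψ
  ; tails        = map t ws
  ; moved        = trans (map-cong-local (All.map hyperplane-form ws-in)) (map-∘ ws)
  ; length-tails = length-map t ws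
  ; nonzero      = All.map⁺ (All.zipWith tail≢𝟎 (ws-in , ws≢𝟎))
  ; values       = map t S , subst (_≤ n) (sym (length-map t S)) |S|≤n
                 , All.map⁺ (All.map (∈-map⁺ t) ws⊆S)
  }
  where
    ψ : Automorphism (suc n)
    ψ = proj₁ (hyperplane n S |S|≤n)

    S-in : All (InHyperplane ∘ to ψ) S
    S-in = proj₂ (hyperplane n S |S|≤n)

    ws-in : All (InHyperplane ∘ to ψ) ws
    ws-in = All.map (All.lookup S-in) ws⊆S

    t : F₂^ (suc n) → F₂^ n
    t = tail ∘ to ψ

    open ≡-Reasoning

    tail≢𝟎 : ∀ {w} → InHyperplane (to ψ w) × w ≢ 𝟎 → t w ≢ 𝟎
    tail≢𝟎 {w} (w-in , w≢𝟎) t≡𝟎 = w≢𝟎 (to-injective ψ (begin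
      to ψ w        ≡⟨ hyperplane-form w-in ⟩
      false ∷ t w   ≡⟨ cong (false ∷_) t≡𝟎 ⟩
      𝟎             ≡⟨ sym (to-𝟎 ψ) ⟩
      to ψ 𝟎        ∎))

++-interchange : ∀ {A : Set} (a b c d : List A) → (a ++ b) ++ (c ++ d) ↭ (a ++ c) ++ (b ++ d)
++-interchange a b c d = begin
  (a ++ b) ++ (c ++ d)  ≡⟨ ++-assoc a b (c ++ d) ⟩
  a ++ (b ++ (c ++ d))  ↭⟨ ++⁺ˡ a (shifts b c) ⟩
  a ++ (c ++ (b ++ d))  ≡⟨ ++-assoc a c (b ++ d) ⟨
  (a ++ c) ++ (b ++ d)  ∎
  where open PermutationReasoning

endpoints : ∀ {A : Set} → List (A × A) → List A
endpoints ps = map proj₁ ps ++ map proj₂ ps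

both : ∀ {A B : Set} → (A → B) → A × A → B × B
both g (x , y) = g x , g y

endpoints-↭ : ∀ {A : Set} {ps qs : List (A × A)} → ps ↭ qs → endpoints ps ↭ endpoints qs
endpoints-↭ ps↭qs = ++⁺ (map⁺ proj₁ ps↭qs) (map⁺ proj₂ ps↭qs)

endpoints-++ : ∀ {A : Set} (ps qs : List (A × A)) → endpoints (ps ++ qs) ↭ endpoints ps ++ endpoints qs
endpoints-++ ps qs = begin
  map proj₁ (ps ++ qs) ++ map proj₂ (ps ++ qs)
    ≡⟨ cong₂ _++_ (map-++ proj₁ ps qs) (map-++ proj₂ ps qs) ⟩
  (map proj₁ ps ++ map proj₁ qs) ++ (map proj₂ ps ++ map proj₂ qs)
    ↭⟨ ++-interchange (map proj₁ ps) (map proj₁ qs) (map proj₂ ps) (map proj₂ qs) ⟩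
  endpoints ps ++ endpoints qs ∎
  where open PermutationReasoning

endpoints-map : ∀ {A B : Set} (g : A → B) ps → endpoints (map (both g) ps) ≡ map g (endpoints ps)
endpoints-map g ps = begin
  map proj₁ (map (both g) ps) ++ map proj₂ (map (both g) ps)
    ≡⟨ cong₂ _++_ (trans (sym (map-∘ ps)) (map-∘ ps)) (trans (sym (map-∘ ps)) (map-∘ ps)) ⟩
  map g (map proj₁ ps) ++ map g (map proj₂ ps)
    ≡⟨ map-++ g (map proj₁ ps) (map proj₂ ps) ⟨
  map g (endpoints ps) ∎
  where open ≡-Reasoning

Enumeration : ∀ {n} → List (F₂^ n) → Set
Enumeration xs = Unique xs × (∀ x → x ∈ xs)

Enumeration-resp-↭ : ∀ {n} {xs ys : List (F₂^ n)} → xs ↭ ys → Enumeration xs → Enumeration ys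
Enumeration-resp-↭ xs↭ys (unique , complete) =
  ↭ₛ.Unique-resp-↭ (setoid _) (↭⇒↭ₛ xs↭ys) unique , λ x → ∈-resp-↭ xs↭ys (complete x)

Enumeration-map : ∀ {n} (ψ : Automorphism n) {xs} → Enumeration xs → Enumeration (map (from ψ) xs)
Enumeration-map ψ (unique , complete) =
  Unique.map⁺ (from-injective ψ) unique ,
  λ x → subst (_∈ _) (from-to ψ x) (∈-map⁺ (from ψ) (complete (to ψ x)))

Enumeration-halves : ∀ {n} {xs ys : List (F₂^ n)} → Enumeration xs → Enumeration ys →
                     Enumeration (map (false ∷_) xs ++ map (true ∷_) ys)
Enumeration-halves {xs = xs} (unique-xs , complete-xs) (unique-ys , complete-ys) =
  Unique.++⁺ (Unique.map⁺ Vec.∷-injectiveʳ unique-xs) (Unique.map⁺ Vec.∷-injectiveʳ unique-ys) disjoint ,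
  complete
  where
    disjoint : Disjoint (map (false ∷_) xs) (map (true ∷_) _)
    disjoint (x∈ , y∈) with ∈-map⁻ (false ∷_) x∈ | ∈-map⁻ (true ∷_) y∈
    ... | _ , _ , refl | _ , _ , ()

    complete : ∀ x → x ∈ map (false ∷_) xs ++ map (true ∷_) _
    complete (false ∷ x) = ∈-++⁺ˡ (∈-map⁺ (false ∷_) (complete-xs x))
    complete (true ∷ x)  = ∈-++⁺ʳ _ (∈-map⁺ (true ∷_) (complete-ys x))

record Pairing {n} (ds : List (F₂^ n)) : Set where
  field
    pairs      : List (F₂^ n × F₂^ n)
    sums       : map (uncurry _⊕_) pairs ≡ ds
    enumerates : Enumeration (endpoints pairs)

open Pairing

pairing-resp-↭ : ∀ {n} {ds ds′ : List (F₂^ n)} → ds ↭ ds′ → Pairing ds′ → Pairing ds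
pairing-resp-↭ ds↭ds′ P with ↭-map-inv (uncurry _⊕_) (subst (_↭ _) (sym (sums P)) (↭-sym ds↭ds′))
... | ps , ds≡ , P↭ps = record
  { pairs      = ps
  ; sums       = sym ds≡
  ; enumerates = Enumeration-resp-↭ (endpoints-↭ P↭ps) (enumerates P)
  }

pairing-transport : ∀ {n} (ψ : Automorphism n) {ds} → Pairing (map (to ψ) ds) → Pairing ds
pairing-transport ψ {ds} P = record
  { pairs      = map (both (from ψ)) (pairs P)
  ; sums       = begin
      map (uncurry _⊕_) (map (both (from ψ)) (pairs P)) ≡⟨ map-∘ (pairs P) ⟨
      map (uncurry _⊕_ ∘ both (from ψ)) (pairs P)        ≡⟨ map-cong (λ (x , y) → sym (from-⊕ ψ x y)) (pairs P) ⟩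
      map (from ψ ∘ uncurry _⊕_) (pairs P)               ≡⟨ map-∘ (pairs P) ⟩
      map (from ψ) (map (uncurry _⊕_) (pairs P))         ≡⟨ cong (map (from ψ)) (sums P) ⟩
      map (from ψ) (map (to ψ) ds)                       ≡⟨ map-∘ ds ⟨
      map (from ψ ∘ to ψ) ds                             ≡⟨ map-cong (from-to ψ) ds ⟩
      map (λ x → x) ds                                   ≡⟨ map-id ds ⟩
      ds                                                 ∎
  ; enumerates = subst Enumeration (sym (endpoints-map (from ψ) (pairs P))) (Enumeration-map ψ (enumerates P))
  }
  where open ≡-Reasoning

pairing-stack : ∀ {n} {ds ds′ : List (F₂^ n)} → Pairing ds → Pairing ds′ → Pairing (map (false ∷_) (ds ++ ds′))
pairing-stack {ds = ds} {ds′} P P′ = record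
  { pairs      = ps₀ ++ ps₁
  ; sums       = begin
      map (uncurry _⊕_) (ps₀ ++ ps₁)                        ≡⟨ map-++ (uncurry _⊕_) ps₀ ps₁ ⟩
      map (uncurry _⊕_) ps₀ ++ map (uncurry _⊕_) ps₁        ≡⟨ cong₂ _++_ (prefixed-sums false P) (prefixed-sums true P′) ⟩
      map (false ∷_) ds ++ map (false ∷_) ds′               ≡⟨ map-++ (false ∷_) ds ds′ ⟨
      map (false ∷_) (ds ++ ds′)                            ∎
  ; enumerates = Enumeration-resp-↭ (↭-sym (endpoints-++ ps₀ ps₁))
      (subst Enumeration (sym (cong₂ _++_ (endpoints-map (false ∷_) (pairs P)) (endpoints-map (true ∷_) (pairs P′))))
        (Enumeration-halves (enumerates P) (enumerates P′)))
  }
  where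
    ps₀ ps₁ : List (F₂^ _ × F₂^ _)
    ps₀ = map (both (false ∷_)) (pairs P)
    ps₁ = map (both (true ∷_)) (pairs P′)

    open ≡-Reasoning

    -- (b, x) + (b, y) = (0, x + y)
    prefixed-sums : ∀ {es} b (Q : Pairing es) → map (uncurry _⊕_) (map (both (b ∷_)) (pairs Q)) ≡ map (false ∷_) es
    prefixed-sums {es} b Q = begin
      map (uncurry _⊕_) (map (both (b ∷_)) (pairs Q))  ≡⟨ map-∘ (pairs Q) ⟨
      map (uncurry _⊕_ ∘ both (b ∷_)) (pairs Q)        ≡⟨ map-cong (λ _ → cong (_∷ _) (Bool.xor-same b)) (pairs Q) ⟩
      map ((false ∷_) ∘ uncurry _⊕_) (pairs Q)         ≡⟨ map-∘ (pairs Q) ⟩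
      map (false ∷_) (map (uncurry _⊕_) (pairs Q))     ≡⟨ cong (map (false ∷_)) (sums Q) ⟩
      map (false ∷_) es                                ∎

pairing-line : (t : F₂^ 1) → t ≢ 𝟎 → Pairing (t ∷ [])
pairing-line (false ∷ []) t≢𝟎 = ⊥-elim (t≢𝟎 refl)
pairing-line (true ∷ [])  _   = record
  { pairs      = (false ∷ [] , true ∷ []) ∷ []
  ; sums       = refl
  ; enumerates = ((λ ()) ∷ []) ∷ [] ∷ [] , λ { (false ∷ []) → here refl ; (true ∷ []) → there (here refl) }
  }

take-within : ∀ {A : Set} {P : A → Set} h (xs ys : List A) → h ≤ length xs → All P xs → All P (take h (xs ++ ys))
take-within zero    xs       ys _         _          = []
take-within (suc h) (x ∷ xs) ys (s≤s h≤) (px ∷ pxs) = px ∷ take-within h xs ys h≤ pxs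

drop-within : ∀ {A : Set} {P : A → Set} h (xs ys : List A) → length xs ≤ h → All P ys → All P (drop h (xs ++ ys))
drop-within h       []       ys _         pys = All.drop⁺ h pys
drop-within (suc h) (x ∷ xs) ys (s≤s ≤h) pys = drop-within h xs ys ≤h pys

other-small : ∀ {h x y} → x + y ≤ h + h → h < x → y ≤ h
other-small x+y≤ h<x = ≮⇒≥ (λ h<y → <⇒≱ (+-mono-< h<x h<y) x+y≤)

two-small : ∀ {h} c₀ c₁ c₂ → c₀ + c₁ ≤ h + h → c₀ + c₂ ≤ h + h → c₁ + c₂ ≤ h + h →
            (c₀ ≤ h × c₁ ≤ h) ⊎ (c₀ ≤ h × c₂ ≤ h) ⊎ (c₁ ≤ h × c₂ ≤ h)
two-small {h} c₀ c₁ c₂ s₀₁ s₀₂ s₁₂ with c₀ ≤? h | c₁ ≤? h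
... | yes c₀≤h | yes c₁≤h = inj₁ (c₀≤h , c₁≤h)
... | yes c₀≤h | no  c₁≰h = inj₂ (inj₁ (c₀≤h , other-small s₁₂ (≰⇒> c₁≰h)))
... | no  c₀≰h | _        = inj₂ (inj₂ (other-small s₀₁ (≰⇒> c₀≰h) , other-small s₀₂ (≰⇒> c₀≰h)))

record Halves {A : Set} (P Q : A → Set) (h : ℕ) (ts : List A) : Set where
  field
    left right   : List A
    split        : ts ↭ left ++ right
    length-left  : length left ≡ h
    length-right : length right ≡ h
    all-left     : All P left
    all-right    : All Q right

Halves-resp-↭ : ∀ {A : Set} {P Q : A → Set} {h} {ts ts′ : List A} → ts ↭ ts′ → Halves P Q h ts′ → Halves P Q h ts
Halves-resp-↭ ts↭ts′ H = record
  { left = left ; right = right ; split = ↭-trans ts↭ts′ split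
  ; length-left = length-left ; length-right = length-right ; all-left = all-left ; all-right = all-right
  }
  where open Halves H

middle-cut : ∀ {A : Set} {P Q : A → Set} h (L : List A) → length L ≡ h + h →
             All P (take h L) → All Q (drop h L) → Halves P Q h L
middle-cut h L |L| all-left all-right = record
  { left         = take h L
  ; right        = drop h L
  ; split        = ↭-reflexive (sym (take++drop≡id h L))
  ; length-left  = trans (length-take h L) (trans (cong (h ⊓_) |L|) (m≤n⇒m⊓n≡m (m≤m+n h h)))
  ; length-right = trans (length-drop h L) (trans (cong (_∸ h) |L|) (m+n∸m≡n h h))
  ; all-left     = all-left
  ; all-right    = all-right
  }

cut-around : ∀ {A : Set} {P Q : A → Set} h (X M Y : List A) → length X ≤ h → length Y ≤ h →
             length (X ++ M ++ Y) ≡ h + h → All P (X ++ M) → All Q (M ++ Y) → Halves P Q h (X ++ M ++ Y)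
cut-around {P = P} h X M Y |X|≤h |Y|≤h |L| all-XM all-MY =
  middle-cut h (X ++ M ++ Y) |L|
    (subst (All P ∘ take h) (++-assoc X M Y) (take-within h (X ++ M) Y h≤|XM| all-XM))
    (drop-within h X (M ++ Y) |X|≤h all-MY)
  where
    |XM|+|Y| : length (X ++ M) + length Y ≡ h + h
    |XM|+|Y| = trans (sym (length-++ (X ++ M))) (trans (cong length (++-assoc X M Y)) |L|)

    h≤|XM| : h ≤ length (X ++ M)
    h≤|XM| = ≮⇒≥ (λ |XM|<h → <⇒≱ (+-mono-<-≤ |XM|<h |Y|≤h) (≤-reflexive (sym |XM|+|Y|)))

module Halving {A : Set} (_≟_ : DecidableEquality A) where

  Halving : ℕ → ℕ → List A → Set
  Halving h b ts = Σ[ S₁ ∈ List A ] Σ[ S₂ ∈ List A ]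
                   (length S₁ ≤ b × length S₂ ≤ b × Halves (_∈ S₁) (_∈ S₂) h ts)

  trivial-halving : ∀ h {b} (S : List A) {ts} → length S ≤ b → All (_∈ S) ts → length ts ≡ h + h → Halving h b ts
  trivial-halving h S {ts} |S| ts⊆S |ts| = S , S , |S| , |S| , middle-cut h ts |ts| (All.take⁺ h ts⊆S) (All.drop⁺ h ts⊆S)

  occurrences : A → List A → List A
  occurrences a = filter (_≟ a)

  others : A → A → List A → List A
  others a b = filter (λ x → ¬? (x ≟ a) ×-dec ¬? (x ≟ b))

  arrange : ∀ {a b} → a ≢ b → ∀ xs → xs ↭ occurrences a xs ++ others a b xs ++ occurrences b xs
  arrange a≢b [] = ↭-refl
  arrange {a} {b} a≢b (x ∷ xs) with x ≟ a | x ≟ b | arrange a≢b xs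
  ... | yes refl | yes refl | _  = ⊥-elim (a≢b refl)
  ... | yes _    | no _     | xs↭ = ↭-prep x xs↭
  ... | no _     | yes _    | xs↭ = ↭-trans (↭-prep x xs↭) (↭-sym (begin
    occurrences a xs ++ others a b xs ++ x ∷ occurrences b xs   ≡⟨ ++-assoc (occurrences a xs) (others a b xs) _ ⟨
    (occurrences a xs ++ others a b xs) ++ x ∷ occurrences b xs ↭⟨ shift x (occurrences a xs ++ others a b xs) _ ⟩
    x ∷ (occurrences a xs ++ others a b xs) ++ occurrences b xs ≡⟨ cong (x ∷_) (++-assoc (occurrences a xs) (others a b xs) _) ⟩
    x ∷ occurrences a xs ++ others a b xs ++ occurrences b xs   ∎))
    where open PermutationReasoning
  ... | no _     | no _     | xs↭ = ↭-trans (↭-prep x xs↭) (↭-sym (shift x (occurrences a xs) _))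

  occurrences-bound : ∀ {a b} → a ≢ b → ∀ xs → length (occurrences a xs) + length (occurrences b xs) ≤ length xs
  occurrences-bound {a} {b} a≢b xs = begin
    length (occurrences a xs) + length (occurrences b xs)
      ≤⟨ +-monoʳ-≤ (length (occurrences a xs)) (m≤n+m _ (length (others a b xs))) ⟩
    length (occurrences a xs) + (length (others a b xs) + length (occurrences b xs))
      ≡⟨ cong (length (occurrences a xs) +_) (length-++ (others a b xs)) ⟨
    length (occurrences a xs) + length (others a b xs ++ occurrences b xs)
      ≡⟨ length-++ (occurrences a xs) ⟨
    length (occurrences a xs ++ others a b xs ++ occurrences b xs)
      ≡⟨ ↭-length (arrange a≢b xs) ⟨
    length xs ∎
    where open ≤-Reasoning

  _∖_ : List A → A → List A
  S ∖ b = filter (λ x → ¬? (x ≟ b)) S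

  ∈-∖ : ∀ {S x b} → x ∈ S → x ≢ b → x ∈ S ∖ b
  ∈-∖ = ∈-filter⁺ (λ x → ¬? (x ≟ _))

  length-∖ : ∀ {S b} → b ∈ S → length (S ∖ b) < length S
  length-∖ {S} b∈S = filter-notAll (λ x → ¬? (x ≟ _)) S (Any.map (λ b≡x x≢b → x≢b (sym b≡x)) b∈S)

  -- If distinct values a, b of S occur at most h times each in ts (whose
  -- h + h entries lie in S), put the a's first and the b's last and cut in
  -- the middle: the left half avoids b and the right half avoids a.
  exclusion-halving : ∀ {h j a b} (S : List A) {ts} → length S ≤ 3 + j → All (_∈ S) ts → length ts ≡ h + h →
                      a ≢ b → a ∈ S → b ∈ S →
                      length (occurrences a ts) ≤ h → length (occurrences b ts) ≤ h → Halving h (2 + j) ts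
  exclusion-halving {h} {j} {a} {b} S {ts} |S| ts⊆S |ts| a≢b a∈S b∈S |A|≤h |B|≤h =
    S ∖ b , S ∖ a , shorter b∈S , shorter a∈S ,
    Halves-resp-↭ (arrange a≢b ts)
      (cut-around h (occurrences a ts) (others a b ts) (occurrences b ts) |A|≤h |B|≤h
        (trans (sym (↭-length (arrange a≢b ts))) |ts|)
        (All.++⁺ (avoiding (_≟ a) (λ x≡a x≡b → a≢b (trans (sym x≡a) x≡b))) (avoiding _ proj₂))
        (All.++⁺ (avoiding _ proj₁) (avoiding (_≟ b) (λ x≡b x≡a → a≢b (trans (sym x≡a) x≡b)))))
    where
      shorter : ∀ {c} → c ∈ S → length (S ∖ c) ≤ 2 + j
      shorter c∈S = ≤-pred (≤-trans (length-∖ c∈S) |S|)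

      avoiding : ∀ {P : A → Set} (P? : Decidable P) {c} → (∀ {x} → P x → x ≢ c) → All (_∈ S ∖ c) (filter P? ts)
      avoiding P? P⇒≢c = All.zipWith (λ (x∈S , px) → ∈-∖ x∈S (P⇒≢c px)) (All.filter⁺ P? ts⊆S , All.all-filter P? ts)

  -- Three distinct values of S: two of them occur at most h times each.
  three-values-halving : ∀ {h j s₀ s₁ s₂} rest {ts} → let S = s₀ ∷ s₁ ∷ s₂ ∷ rest in
                         s₀ ≢ s₁ → s₀ ≢ s₂ → s₁ ≢ s₂ → length S ≤ 3 + j → All (_∈ S) ts → length ts ≡ h + h →
                         Halving h (2 + j) ts
  three-values-halving {h} {j} {s₀} {s₁} {s₂} rest {ts} s₀≢s₁ s₀≢s₂ s₁≢s₂ |S| ts⊆S |ts|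
    with two-small (count s₀) (count s₁) (count s₂) (bound s₀≢s₁) (bound s₀≢s₂) (bound s₁≢s₂)
    where
      count : A → ℕ
      count s = length (occurrences s ts)

      bound : ∀ {a b} → a ≢ b → count a + count b ≤ h + h
      bound {a} {b} a≢b = subst (count a + count b ≤_) |ts| (occurrences-bound a≢b ts)
  ... | inj₁ (c₀ , c₁)        = exclusion-halving _ |S| ts⊆S |ts| s₀≢s₁ (here refl) (there (here refl)) c₀ c₁
  ... | inj₂ (inj₁ (c₀ , c₂)) = exclusion-halving _ |S| ts⊆S |ts| s₀≢s₂ (here refl) (there (there (here refl))) c₀ c₂
  ... | inj₂ (inj₂ (c₁ , c₂)) = exclusion-halving _ |S| ts⊆S |ts| s₁≢s₂ (there (here refl)) (there (there (here refl))) c₁ c₂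

  distinct-halving : ∀ h j (S : List A) {ts} → Unique S → length S ≤ 3 + j → All (_∈ S) ts → length ts ≡ h + h →
                     Halving h (2 + j) ts
  distinct-halving h j []                 _ _ = trivial-halving h [] z≤n
  distinct-halving h j (s ∷ [])           _ _ = trivial-halving h (s ∷ []) (s≤s z≤n)
  distinct-halving h j (s₀ ∷ s₁ ∷ [])     _ _ = trivial-halving h (s₀ ∷ s₁ ∷ []) (s≤s (s≤s z≤n))
  distinct-halving h j (s₀ ∷ s₁ ∷ s₂ ∷ rest) ((s₀≢s₁ ∷ s₀≢s₂ ∷ _) ∷ (s₁≢s₂ ∷ _) ∷ _) =
    three-values-halving rest s₀≢s₁ s₀≢s₂ s₁≢s₂

  halve : ∀ j (ts : List A) → length ts ≡ 2 ^ suc j → AtMostValues (2 + j) ts → Halving (2 ^ j) (suc j) ts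
  halve zero (x ∷ y ∷ []) _ _ = x ∷ [] , y ∷ [] , s≤s z≤n , s≤s z≤n , record
    { left = x ∷ [] ; right = y ∷ [] ; split = ↭-refl ; length-left = refl ; length-right = refl
    ; all-left = here refl ∷ [] ; all-right = here refl ∷ [] }
  halve (suc j) ts |ts| (S , |S| , ts⊆S) =
    distinct-halving (2 ^ suc j) j (deduplicate _≟_ S) (deduplicate-! _≟_ S)
      (≤-trans (length-deduplicate _≟_ S) |S|) (All.map (∈-deduplicate⁺ _≟_) ts⊆S)
      (trans |ts| (cong (2 ^ suc j +_) (+-identityʳ (2 ^ suc j))))

pairing-doubled : ∀ k (ws : List (F₂^ (2 + k))) → length ws ≡ 2 ^ k → All (_≢ 𝟎) ws →
                  AtMostValues (suc k) ws → Pairing (ws ++ ws)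
pairing-tails   : ∀ k (ts : List (F₂^ (suc k))) → length ts ≡ 2 ^ k → All (_≢ 𝟎) ts →
                  AtMostValues (suc k) ts → Pairing (map (false ∷_) (ts ++ ts))

pairing-doubled k ws |ws| ws≢𝟎 ws-values =
  pairing-transport ψ (subst Pairing (sym moved-twice) (pairing-tails k tails (trans length-tails |ws|) nonzero values))
  where
    open Reduction (reduce-dimension ws ws≢𝟎 ws-values)
    open ≡-Reasoning

    moved-twice : map (to ψ) (ws ++ ws) ≡ map (false ∷_) (tails ++ tails)
    moved-twice = begin
      map (to ψ) (ws ++ ws)                        ≡⟨ map-++ (to ψ) ws ws ⟩
      map (to ψ) ws ++ map (to ψ) ws               ≡⟨ cong₂ _++_ moved moved ⟩
      map (false ∷_) tails ++ map (false ∷_) tails ≡⟨ map-++ (false ∷_) tails tails ⟨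
      map (false ∷_) (tails ++ tails)              ∎

pairing-tails zero [] () _ _
pairing-tails zero (t ∷ []) _ (t≢𝟎 ∷ []) _ = pairing-stack (pairing-line t t≢𝟎) (pairing-line t t≢𝟎)
pairing-tails zero (_ ∷ _ ∷ _) () _ _
pairing-tails (suc j) ts |ts| ts≢𝟎 ts-values with Halving.halve (Vec.≡-dec Bool._≟_) j ts |ts| ts-values
... | S₁ , S₂ , |S₁| , |S₂| , H =
  pairing-resp-↭ (map⁺ (false ∷_) (↭-trans (++⁺ split split) (++-interchange left right left right)))
    (pairing-stack (pairing-doubled j left  length-left  (All.++⁻ˡ left halves≢𝟎) (S₁ , |S₁| , all-left))
                   (pairing-doubled j right length-right (All.++⁻ʳ left halves≢𝟎) (S₂ , |S₂| , all-right)))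
  where
    open Halves H

    halves≢𝟎 : All (_≢ 𝟎) (left ++ right)
    halves≢𝟎 = All-resp-↭ split ts≢𝟎

map-≡-tabulate : ∀ {A B : Set} {N} (f : A → B) (xs : List A) (v : Fin N → B) → map f xs ≡ tabulate v →
                 Σ[ w ∈ (Fin N → A) ] (xs ≡ tabulate w × ∀ i → f (w i) ≡ v i)
map-≡-tabulate {N = zero}  f []       v refl = (λ ()) , refl , λ ()
map-≡-tabulate {N = suc N} f (x ∷ xs) v fxs≡ with map-≡-tabulate f xs (v ∘ Fin.suc) (∷-injectiveʳ fxs≡)
... | w , xs≡ , fw≡ = (λ { Fin.zero → x ; (Fin.suc i) → w i }) , cong (x ∷_) xs≡ ,
                      λ { Fin.zero → ∷-injectiveˡ fxs≡ ; (Fin.suc i) → fw≡ i }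

Unique-++⁻ : ∀ {A : Set} (xs : List A) {ys} → Unique (xs ++ ys) →
             Unique xs × Unique ys × (∀ {x y} → x ∈ xs → y ∈ ys → x ≢ y)
Unique-++⁻ []       unique            = [] , unique , λ ()
Unique-++⁻ (x ∷ xs) (x∉ ∷ unique) with Unique-++⁻ xs unique
... | unique-xs , unique-ys , disjoint =
  All.++⁻ˡ xs x∉ ∷ unique-xs , unique-ys ,
  λ { (here refl) y∈ → All.lookup (All.++⁻ʳ xs x∉) y∈ ; (there x∈) y∈ → disjoint x∈ y∈ }

tabulate-injective : ∀ {A : Set} {N} {f : Fin N → A} → Unique (tabulate f) → ∀ {i j} → f i ≡ f j → i ≡ j
tabulate-injective {N = suc N} _              {Fin.zero}  {Fin.zero}  _  = refl
tabulate-injective {N = suc N} (f₀∉ ∷ _)      {Fin.zero}  {Fin.suc j} eq = ⊥-elim (All.tabulate⁻ f₀∉ j eq)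
tabulate-injective {N = suc N} (f₀∉ ∷ _)      {Fin.suc i} {Fin.zero}  eq = ⊥-elim (All.tabulate⁻ f₀∉ i (sym eq))
tabulate-injective {N = suc N} (_   ∷ unique) {Fin.suc i} {Fin.suc j} eq = cong Fin.suc (tabulate-injective unique eq)

tabulate-++-bijective : ∀ {A : Set} {M N} (f : Fin M → A) (g : Fin N → A) →
                        Unique (tabulate f ++ tabulate g) → (∀ a → a ∈ tabulate f ++ tabulate g) →
                        Bijective _≡_ _≡_ [ f , g ]
tabulate-++-bijective {M = M} {N} f g unique complete = injective , surjective
  where
    parts : Unique (tabulate f) × Unique (tabulate g) × (∀ {x y} → x ∈ tabulate f → y ∈ tabulate g → x ≢ y)
    parts = Unique-++⁻ (tabulate f) unique

    injective : ∀ {x y} → [ f , g ] x ≡ [ f , g ] y → x ≡ y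
    injective {inj₁ i} {inj₁ j} eq = cong inj₁ (tabulate-injective (proj₁ parts) eq)
    injective {inj₁ i} {inj₂ j} eq = ⊥-elim (proj₂ (proj₂ parts) (∈-tabulate⁺ i) (∈-tabulate⁺ j) eq)
    injective {inj₂ i} {inj₁ j} eq = ⊥-elim (proj₂ (proj₂ parts) (∈-tabulate⁺ j) (∈-tabulate⁺ i) (sym eq))
    injective {inj₂ i} {inj₂ j} eq = cong inj₂ (tabulate-injective (proj₁ (proj₂ parts)) eq)

    surjective : ∀ a → Σ[ x ∈ Fin M ⊎ Fin N ] (∀ {z} → z ≡ x → [ f , g ] z ≡ a)
    surjective a with ∈-++⁻ (tabulate f) (complete a)
    ... | inj₁ a∈ = let (i , a≡) = ∈-tabulate⁻ a∈ in inj₁ i , λ { refl → sym a≡ }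
    ... | inj₂ a∈ = let (i , a≡) = ∈-tabulate⁻ a∈ in inj₂ i , λ { refl → sym a≡ }

pairing-functions : ∀ {n N} (v : Fin N → F₂^ n) → Pairing (tabulate v) →
                    Σ[ p ∈ (Fin N → F₂^ n) ] Σ[ q ∈ (Fin N → F₂^ n) ] (Bijective _≡_ _≡_ [ p , q ] × (∀ i → p i ⊕ q i ≡ v i))
pairing-functions v P with map-≡-tabulate (uncurry _⊕_) (pairs P) v (sums P)
... | w , pairs≡ , sum≡ =
  proj₁ ∘ w , proj₂ ∘ w , tabulate-++-bijective (proj₁ ∘ w) (proj₂ ∘ w) (proj₁ enumerates-w) (proj₂ enumerates-w) , sum≡
  where
    enumerates-w : Enumeration (tabulate (proj₁ ∘ w) ++ tabulate (proj₂ ∘ w))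
    enumerates-w = subst Enumeration
      (trans (cong endpoints pairs≡) (cong₂ _++_ (map-tabulate w proj₁) (map-tabulate w proj₂)))
      (enumerates P)

doubled-tabulate : ∀ {A : Set} K {N} (v : Fin N → A) → N ≡ 2 * K →
                   (∀ (k : ℕ) (i j : Fin N) → toℕ i ≡ 2 * k → toℕ j ≡ suc (2 * k) → v i ≡ v j) →
                   Σ[ ws ∈ List A ] (length ws ≡ K × tabulate v ↭ ws ++ ws)
doubled-tabulate zero v refl _ = [] , refl , ↭-refl
doubled-tabulate (suc K) v N≡ consecutive with trans N≡ (*-suc 2 K)
... | refl with doubled-tabulate K (v ∘ Fin.suc ∘ Fin.suc) refl consecutive′
  where
    consecutive′ : ∀ (k : ℕ) i j → toℕ i ≡ 2 * k → toℕ j ≡ suc (2 * k) → v (Fin.suc (Fin.suc i)) ≡ v (Fin.suc (Fin.suc j))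
    consecutive′ k i j i≡ j≡ = consecutive (suc k) _ _
      (trans (cong (suc ∘ suc) i≡) (sym (*-suc 2 k))) (trans (cong (suc ∘ suc) j≡) (cong suc (sym (*-suc 2 k))))
... | ws , |ws| , tabulate↭ = v Fin.zero ∷ ws , cong suc |ws| , (begin
  v Fin.zero ∷ v (Fin.suc Fin.zero) ∷ tabulate (v ∘ Fin.suc ∘ Fin.suc)
    ≡⟨ cong (λ x → v Fin.zero ∷ x ∷ tabulate (v ∘ Fin.suc ∘ Fin.suc)) (sym (consecutive 0 Fin.zero (Fin.suc Fin.zero) refl refl)) ⟩
  v Fin.zero ∷ v Fin.zero ∷ tabulate (v ∘ Fin.suc ∘ Fin.suc)
    ↭⟨ ↭-prep _ (↭-prep _ tabulate↭) ⟩
  v Fin.zero ∷ v Fin.zero ∷ ws ++ ws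
    ↭⟨ ↭-prep _ (shift (v Fin.zero) ws ws) ⟨
  v Fin.zero ∷ ws ++ v Fin.zero ∷ ws ∎)
  where open PermutationReasoning

lemma6 : (m : ℕ) → let n = suc (suc m) in
    (v : Fin (2 ^ suc m) → F₂^ n) →
    (∀ i → v i ≢ 𝟎) →
    (∀ (k : ℕ) (i j : Fin (2 ^ suc m)) → toℕ i ≡ 2 * k → toℕ j ≡ suc (2 * k) → v i ≡ v j) →
    (l : ℕ) → l < n →
    (Σ[ S ∈ List (F₂^ n) ] (length S ≡ l × (∀ i → v i ∈ S))) →
    Σ[ p ∈ (Fin (2 ^ suc m) → F₂^ n) ] Σ[ q ∈ (Fin (2 ^ suc m) → F₂^ n) ]
    (Bijective _≡_ _≡_ [ p , q ] ×
    (∀ i → p i ⊕ q i ≡ v i))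
lemma6 m v v≢𝟎 consecutive l l<n (S , |S|≡l , v∈S) =
  pairing-functions v (pairing-resp-↭ tabulate↭ (pairing-doubled m ws |ws| (entries v≢𝟎) (S , |S|≤ , entries v∈S)))
  where
    doubled : Σ[ ws ∈ List (F₂^ (suc (suc m))) ] (length ws ≡ 2 ^ m × tabulate v ↭ ws ++ ws)
    doubled = doubled-tabulate (2 ^ m) v refl consecutive

    ws : List (F₂^ (suc (suc m)))
    ws = proj₁ doubled

    |ws| : length ws ≡ 2 ^ m
    |ws| = proj₁ (proj₂ doubled)

    tabulate↭ : tabulate v ↭ ws ++ ws
    tabulate↭ = proj₂ (proj₂ doubled)

    entries : ∀ {P : F₂^ (suc (suc m)) → Set} → (∀ i → P (v i)) → All P ws
    entries Pv = All.++⁻ˡ ws (All-resp-↭ tabulate↭ (All.tabulate⁺ Pv))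

    |S|≤ : length S ≤ suc m
    |S|≤ = subst (_≤ suc m) (sym |S|≡l) (≤-pred l<n)
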